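{- Let $A=(I_{pr},O_{pr},Q^A,Q^A_0,\delta^A,out^A,A^A_{loc})$ and $B=(I_{pr},O_{pr},Q^B,Q^B_0,\delta^B,out^B,A^B_{loc})$ be process templates, with no global inputs, and assume that initially the process $A$ has the token. Let $\psi(p)$ denote an LTL formula over the propositions of a process $p$. Then $(1,1)$ (one $A$-process and one $B$-process) is a cutoff for each of the following parameterized model checking problems: (1) $\forall n:\ (A,B)^{(1,n)}\models A^A_{loc}\wedge\mathsf G\mathsf F\,\mathsf{tok}_A\rightarrow\psi(A)$; (2) $\forall n:\ (A,B)^{(1,n)}\models\forall i:\ A^B_{loc,i}\wedge\mathsf G\mathsf F\,\mathsf{tok}_i\rightarrow\psi(B_i)$, i.e., for every $n\ge1$, $(A,B)^{(1,1)}$ satisfies the respective formula iff $(A,B)^{(1,n)}$ does.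
   Context: A process template is $P=(I_{pr},O_{pr},Q,Q_0,\delta,out,A_{loc})$ with disjoint finite sets of inputs $I_{pr}\ni\mathsf{rcv}$ and outputs $O_{pr}\ni\mathsf{snd},\mathsf{tok}$; finite states $Q=T\,\dot\cup\,NT$ (states in $T$ "have the token"), both nonempty; initial states $Q_0=\{\iota_t,\iota_n\}$ with $\iota_t\in T$, $\iota_n\in NT$; output function $out:Q\to2^{O_{pr}}$ with $\mathsf{tok}\in out(q)$ iff $q\in T$, and $\mathsf{snd}\in out(q)$ only if $q\in T$; transition relation $\delta\subseteq Q\times2^{I_{pr}}\times Q$ such that a state in $T$ with $\mathsf{snd}$ moves on inputs without $\mathsf{rcv}$ to $NT$, a state in $NT$ moves on inputs with $\mathsf{rcv}$ to $T$ and on inputs without $\mathsf{rcv}$ to $NT$, a state in $T$ without $\mathsf{snd}$ moves on inputs without $\mathsf{rcv}$ to $T$, with a successor for every $q\in NT$ and every input, and for every $q\in T$ and every input without $\mathsf{rcv}$; $A_{loc}$ is a fairness condition (LTL over $I_{pr}\cup O_{pr}$) such that every infinite path from an initial state satisfying $A_{loc}$ satisfies $\mathsf G(\mathsf{tok}\rightarrow\mathsf F\,\mathsf{snd})$. The (fully asynchronous) token ring $(A,B)^{(1,n)}$ consists of processes $A,B_1,\dots,B_n$ arranged in the ring $A\to B_1\to\dots\to B_n\to A$; each process has its own copy of the inputs $I_{pr}$ and outputs $O_{pr}$ (propositions of process $p$ are written with subscript $p$). Global states assign a local state to each process; in the initial global state considered here, $A$ is in its state $\iota_t$ and each $B_j$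 in its state $\iota_n$. A global step chooses a set $M$ of moving processes and a system input: either an internal step, in which no process in $M$ is in a $\mathsf{snd}$ state or receives $\mathsf{rcv}$, and each process in $M$ takes a transition of its template on its input while others stay; or a token-passing step, in which $M$ contains a process $v$ in a $\mathsf{snd}$ state and its ring successor $w$, $w$ receives $\mathsf{rcv}$, no other process in $M$ sends or receives, and every process in $M$ takes a template transition. A run is an infinite sequence of such steps from the initial global state; it is read as the sequence of (outputs of all processes, inputs of all processes) together with the moving sets $M_j$; for $\mathsf X$ inside a formula about process $v$, $\mathsf X\varphi$ holds at position $j$ iff $\varphi$ holds from the position of the second index $\ge j$ at which $v$ moves. The system satisfies a formula iff all its infinite runs do; $\forall i$ ranges over $B_1,\dots,B_n$, and $A^B_{loc,i}$ is $A^B_{loc}$ with propositions indexed by $i$. A cutoff $c$ for a formula means: for all $n\ge c$, the system of size $c$ satisfies it iff the system of size $n$ does. -}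

module Defs where

open import Data.Nat using (ℕ; zero; suc; _≤_; _<_)
open import Data.Fin using (Fin; zero; suc)
open import Data.Bool using (Bool; true; false)
open import Data.Sum using (_⊎_; inj₁; inj₂)
open import Data.Product using (Σ; _×_; _,_; ∃)
open import Relation.Binary.PropositionalEquality using (_≡_; _≢_)
open import Relation.Nullary using (¬_)
open import Function.Bundles using (_⇔_)

-- Semantics is relative to a "moves" predicate: X φ holds at j iff φ
-- holds at the second index ≥ j at which the process moves (as in the
-- paper).  For ordinary (local) paths, moves = const true, so X is the
-- usual next operator.

data LTL (AP : Set) : Set where
  trueₗ : LTL AP
  atom  : AP → LTL AP
  ¬ₗ_   : LTL AP → LTL AP
  _∧ₗ_  : LTL AP → LTL AP → LTL AP
  _∨ₗ_  : LTL AP → LTL AP → LTL AP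
  _⇒ₗ_  : LTL AP → LTL AP → LTL AP
  Xₗ    : LTL AP → LTL AP
  Gₗ    : LTL AP → LTL AP
  _Uₗ_  : LTL AP → LTL AP → LTL AP

Fₗ : {AP : Set} → LTL AP → LTL AP
Fₗ φ = trueₗ Uₗ φ

mapLTL : {AP AP' : Set} → (AP → AP') → LTL AP → LTL AP'
mapLTL f trueₗ = trueₗ
mapLTL f (atom a) = atom (f a)
mapLTL f (¬ₗ φ) = ¬ₗ mapLTL f φ
mapLTL f (φ ∧ₗ ψ) = mapLTL f φ ∧ₗ mapLTL f ψ
mapLTL f (φ ∨ₗ ψ) = mapLTL f φ ∨ₗ mapLTL f ψ
mapLTL f (φ ⇒ₗ ψ) = mapLTL f φ ⇒ₗ mapLTL f ψ
mapLTL f (Xₗ φ) = Xₗ (mapLTL f φ)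
mapLTL f (Gₗ φ) = Gₗ (mapLTL f φ)
mapLTL f (φ Uₗ ψ) = mapLTL f φ Uₗ mapLTL f ψ

SecondMove : (ℕ → Bool) → ℕ → ℕ → Set
SecondMove moves j k =
  Σ ℕ λ k₁ → (j ≤ k₁) × (k₁ < k) × (moves k₁ ≡ true) × (moves k ≡ true) ×
    ((l : ℕ) → j ≤ l → l < k → moves l ≡ true → l ≡ k₁)

⟦_⟧ : {AP : Set} → LTL AP → (moves : ℕ → Bool) → (w : ℕ → AP → Bool) → ℕ → Set
⟦ trueₗ ⟧ mv w i = Data.Unit.⊤ where import Data.Unit
⟦ atom a ⟧ mv w i = w i a ≡ true
⟦ ¬ₗ φ ⟧ mv w i = ¬ ⟦ φ ⟧ mv w i
⟦ φ ∧ₗ ψ ⟧ mv w i = ⟦ φ ⟧ mv w i × ⟦ ψ ⟧ mv w i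
⟦ φ ∨ₗ ψ ⟧ mv w i = ⟦ φ ⟧ mv w i ⊎ ⟦ ψ ⟧ mv w i
⟦ φ ⇒ₗ ψ ⟧ mv w i = ⟦ φ ⟧ mv w i → ⟦ ψ ⟧ mv w i
⟦ Xₗ φ ⟧ mv w i = Σ ℕ λ k → SecondMove mv i k × ⟦ φ ⟧ mv w k
⟦ Gₗ φ ⟧ mv w i = (k : ℕ) → i ≤ k → ⟦ φ ⟧ mv w k
⟦ φ Uₗ ψ ⟧ mv w i =
  Σ ℕ λ k → (i ≤ k) × ⟦ ψ ⟧ mv w k × ((l : ℕ) → i ≤ l → l < k → ⟦ φ ⟧ mv w l)

record Signature : Set where
  field
    nI  : ℕ
    nO  : ℕ
    rcv : Fin nI
    snd : Fin nO
    tok : Fin nO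
    snd≢tok : snd ≢ tok

  Input : Set
  Input = Fin nI → Bool

  AP : Set
  AP = Fin nI ⊎ Fin nO

record Template (S : Signature) : Set₁ where
  open Signature S
  field
    nQ     : ℕ
    hasTok : Fin nQ → Bool         -- q ∈ T  iff  hasTok q ≡ true
    ιt     : Fin nQ
    ιn     : Fin nQ
    ιt∈T   : hasTok ιt ≡ true
    ιn∈NT  : hasTok ιn ≡ false
    out    : Fin nQ → Fin nO → Bool
    δ      : Fin nQ → Input → Fin nQ → Bool
    Aloc   : LTL AP
    out-tok : ∀ q → out q tok ≡ hasTok q
    out-snd : ∀ q → out q snd ≡ true → hasTok q ≡ true
    δ-T-snd   : ∀ q σ q' → hasTok q ≡ true → out q snd ≡ true → σ rcv ≡ false →
                δ q σ q' ≡ true → hasTok q' ≡ false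
    δ-NT-rcv  : ∀ q σ q' → hasTok q ≡ false → σ rcv ≡ true →
                δ q σ q' ≡ true → hasTok q' ≡ true
    δ-NT-nrcv : ∀ q σ q' → hasTok q ≡ false → σ rcv ≡ false →
                δ q σ q' ≡ true → hasTok q' ≡ false
    δ-T-nsnd  : ∀ q σ q' → hasTok q ≡ true → out q snd ≡ false → σ rcv ≡ false →
                δ q σ q' ≡ true → hasTok q' ≡ true
    total-NT  : ∀ q σ → hasTok q ≡ false → ∃ λ q' → δ q σ q' ≡ true
    total-T   : ∀ q σ → hasTok q ≡ true → σ rcv ≡ false → ∃ λ q' → δ q σ q' ≡ true

  localLabel : Fin nQ → Input → AP → Bool
  localLabel q σ (inj₁ i) = σ i
  localLabel q σ (inj₂ o) = out q o

  record Path : Set where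
    field
      st   : ℕ → Fin nQ
      inp  : ℕ → Input
      init : (st 0 ≡ ιt) ⊎ (st 0 ≡ ιn)
      step : ∀ j → δ (st j) (inp j) (st (suc j)) ≡ true

    label : ℕ → AP → Bool
    label j = localLabel (st j) (inp j)

FairTemplate : {S : Signature} → Template S → Set
FairTemplate {S} P =
  (π : Path) → ⟦ Aloc ⟧ (λ _ → true) (Path.label π) 0 →
  ⟦ Gₗ (atom (inj₂ tok) ⇒ₗ Fₗ (atom (inj₂ snd))) ⟧ (λ _ → true) (Path.label π) 0
  where open Signature S
        open Template P

-- Token ring (A,B)^{(1,n)}: process zero is A, process suc i is B_{i+1}

-- ring successor on Fin (suc n):  p ↦ p+1 mod (n+1)
ringSucc : (n : ℕ) → Fin (suc n) → Fin (suc n)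
ringSucc zero zero = zero
ringSucc (suc n) zero = suc zero
ringSucc (suc n) (suc i) with ringSucc n i
... | zero  = zero
... | suc j = suc (suc j)

module Ring {S : Signature} (A B : Template S) (n : ℕ) where
  open Signature S

  Proc : Set
  Proc = Fin (suc n)

  tmpl : Proc → Template S
  tmpl zero    = A
  tmpl (suc _) = B

  LState : Proc → Set
  LState p = Fin (Template.nQ (tmpl p))

  GState : Set
  GState = (p : Proc) → LState p

  initState : GState
  initState zero    = Template.ιt A
  initState (suc _) = Template.ιn B

  outP : (p : Proc) → LState p → Fin nO → Bool
  outP p = Template.out (tmpl p)

  δP : (p : Proc) → LState p → Input → LState p → Bool
  δP p = Template.δ (tmpl p)

  GInput : Set
  GInput = Proc → Input

  Internal : GState → GInput → (Proc → Bool) → Set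
  Internal s e M = ∀ p → M p ≡ true → (outP p (s p) snd ≡ false) × (e p rcv ≡ false)

  TokenPass : GState → GInput → (Proc → Bool) → Set
  TokenPass s e M = Σ Proc λ v →
    (outP v (s v) snd ≡ true) × (M v ≡ true) × (M (ringSucc n v) ≡ true) ×
    (e (ringSucc n v) rcv ≡ true) ×
    (∀ p → M p ≡ true → p ≢ v → outP p (s p) snd ≡ false) ×
    (∀ p → M p ≡ true → p ≢ ringSucc n v → e p rcv ≡ false)

  Step : GState → GInput → (Proc → Bool) → GState → Set
  Step s e M s' =
    (Internal s e M ⊎ TokenPass s e M) ×
    (∀ p → M p ≡ true → δP p (s p) (e p) (s' p) ≡ true) ×
    (∀ p → M p ≡ false → s' p ≡ s p)

  record Run : Set where
    field
      st    : ℕ → GState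
      inp   : ℕ → GInput
      moving : ℕ → Proc → Bool
      init  : ∀ p → st 0 p ≡ initState p
      step  : ∀ j → Step (st j) (inp j) (moving j) (st (suc j))

    label : ℕ → Proc × AP → Bool
    label j (p , inj₁ i) = inp j p i
    label j (p , inj₂ o) = outP p (st j p) o

    movesOf : Proc → ℕ → Bool
    movesOf p j = moving j p

  at : Proc → LTL AP → LTL (Proc × AP)
  at p = mapLTL (λ a → (p , a))

  tokOf : Proc → LTL (Proc × AP)
  tokOf p = atom (p , inj₂ tok)

  SatA : LTL AP → Set
  SatA ψ = (r : Run) →
    ⟦ (at zero (Template.Aloc A) ∧ₗ Gₗ (Fₗ (tokOf zero))) ⇒ₗ at zero ψ ⟧
      (Run.movesOf r zero) (Run.label r) 0

  SatB : LTL AP → Set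
  SatB ψ = (r : Run) → (i : Fin n) →
    ⟦ (at (suc i) (Template.Aloc B) ∧ₗ Gₗ (Fₗ (tokOf (suc i)))) ⇒ₗ at (suc i) ψ ⟧
      (Run.movesOf r (suc i)) (Run.label r) 0

{-# OPTIONS --safe #-}
-- Each direction compares a run of one ring with a run of the other in which the observed process
-- performs exactly the same local computation, interleaved with steps in which it does not move.
-- Such a stuttering preserves every formula about that process, because X refers to the process's
-- own next move.
--
-- From (A,B)^(1,1) to (A,B)^(1,n), A and B₁ replay A and B step by step; whenever B hands the token
-- to A, the copies B₂, …, Bₙ in turn replay B's computation since A last received it, each taking
-- the token from its predecessor at the point where B took it from A, and Bₙ finally hands it to A.
-- From (A,B)^(1,n) to (A,B)^(1,1), the run is projected onto A and one B process (Bₙ when A is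
-- observed, Bᵢ when Bᵢ is), each following its own computation with its own clock.  A token pass of
-- the observed process is synchronised with the next pass of its partner, which exists because
-- G F tok brings the token back to the observed process, and on its way round the ring it passes
-- the partner.  Neither direction uses the fairness conditions of the templates.
module Submission where

open import Defs
open import Data.Bool using (Bool; true; false; _∧_; _∨_; if_then_else_)
open import Data.Fin using (Fin; zero; suc; toℕ; fromℕ)
open import Data.Fin.Properties using (toℕ-fromℕ; toℕ-injective; toℕ<n) renaming (_≟_ to _≟ᶠ_)
open import Data.List using (List; []; _∷_; _++_; replicate; length)
open import Data.Nat using (ℕ; zero; suc; _+_; _∸_; _≤_; _<_; z≤n; s≤s; z<s; _≤?_; _<?_)
open import Data.Nat.Properties
open import Data.Product using (Σ; ∃; _×_; _,_; proj₁; proj₂)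
open import Data.Product.Function.NonDependent.Propositional using (_×-⇔_)
open import Data.Sum using (_⊎_; inj₁; inj₂)
open import Data.Sum.Function.Propositional using (_⊎-⇔_)
open import Data.Unit using (⊤; tt)
open import Function.Base using (_∘_)
open import Function.Bundles using (_⇔_; mk⇔; Equivalence)
open import Function.Properties.Equivalence using () renaming (trans to ⇔-trans; sym to ⇔-sym)
open import Function.Related.TypeIsomorphisms using (→-cong-⇔; ¬-cong-⇔)
open import Level using (0ℓ)
open import Relation.Binary.PropositionalEquality
open import Relation.Nullary using (¬_; yes; no; does; contradiction)
open import Relation.Nullary.Decidable using (dec-true; dec-false; ¬?; decidable-stable)
open import Relation.Unary using (Pred; Decidable)

open Equivalence using (to; from)

Throughout : Pred ℕ 0ℓ → ℕ → ℕ → Set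
Throughout P a b = ∀ t → a ≤ t → t ≤ b → P t

throughout-single : ∀ {P : Pred ℕ 0ℓ} {a} → P a → Throughout P a a
throughout-single {P} Pa t a≤t t≤a = subst P (≤-antisym a≤t t≤a) Pa

throughout-extend : ∀ {P : Pred ℕ 0ℓ} {a b} → Throughout P a b → P (suc b) → Throughout P a (suc b)
throughout-extend {P} {b = b} all Pb+1 t a≤t t≤b+1 with m≤n⇒m<n∨m≡n t≤b+1
... | inj₁ t<b+1 = all t a≤t (≤-pred t<b+1)
... | inj₂ refl  = Pb+1

FirstEntry : Pred ℕ 0ℓ → ℕ → ℕ → Set
FirstEntry P a b = ∃ λ s → a ≤ s × s < b × Throughout (λ t → ¬ P t) a s × P (suc s)

first-entry : {P : Pred ℕ 0ℓ} → Decidable P → ∀ {a b} → a ≤ b → ¬ P a → P b → FirstEntry P a b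
first-entry {P} P? {a} a≤b ¬Pa Pb =
  subst (FirstEntry P a) (m+[n∸m]≡n a≤b) (search _ ¬Pa (subst P (sym (m+[n∸m]≡n a≤b)) Pb))
  where
  search : ∀ {a} k → ¬ P a → P (a + k) → FirstEntry P a (a + k)
  search {a} zero ¬Pa Pa+0 = contradiction (subst P (+-identityʳ a) Pa+0) ¬Pa
  search {a} (suc k) ¬Pa Pb with P? (suc a)
  ... | yes Pa+1 = a , ≤-refl , m<m+n a z<s , below , Pa+1
    where
    below : Throughout (λ t → ¬ P t) a a
    below l a≤l l≤a = subst (λ x → ¬ P x) (≤-antisym a≤l l≤a) ¬Pa
  ... | no ¬Pa+1 with search k ¬Pa+1 (subst P (+-suc a k) Pb)
  ...   | s , a<s , s<b , below , Ps+1 = s , <⇒≤ a<s , subst (s <_) (sym (+-suc a k)) s<b , below′ , Ps+1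
    where
    below′ : Throughout (λ t → ¬ P t) a s
    below′ l a≤l l≤s with m≤n⇒m<n∨m≡n a≤l
    ... | inj₁ a<l = below l a<l l≤s
    ... | inj₂ refl = ¬Pa

first-exit : {P : Pred ℕ 0ℓ} → Decidable P → ∀ {a b} → a ≤ b → P a → ¬ P b →
             ∃ λ s → a ≤ s × s < b × Throughout P a s × ¬ P (suc s)
first-exit {P} P? a≤b Pa ¬Pb with first-entry (λ t → ¬? (P? t)) a≤b (λ ¬Pa → ¬Pa Pa) ¬Pb
... | s , a≤s , s<b , below , ¬Ps+1 =
      s , a≤s , s<b , (λ t a≤t t≤s → decidable-stable (P? t) (below t a≤t t≤s)) , ¬Ps+1

-- (mv′ , w′) repeats each step orig t of (mv , w), moving at most at the last repetition.
record Stuttering {X : Set} (mv′ : ℕ → Bool) (w′ : ℕ → X → Bool)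
                            (mv : ℕ → Bool) (w : ℕ → X → Bool) : Set where
  field
    orig       : ℕ → ℕ
    orig-zero  : orig 0 ≡ 0
    orig-step  : ∀ t → (orig (suc t) ≡ orig t × mv′ t ≡ false)
                     ⊎ (orig (suc t) ≡ suc (orig t) × mv′ t ≡ mv (orig t))
    label-orig : ∀ t a → w′ t a ≡ w (orig t) a
    orig-onto  : ∀ m → ∃ λ t → orig t ≡ m

module StutteringProperties {X : Set} {mv′ mv : ℕ → Bool} {w′ w : ℕ → X → Bool}
                            (E : Stuttering mv′ w′ mv w) where
  open Stuttering E

  orig-suc-≤ : ∀ t → orig (suc t) ≤ suc (orig t)
  orig-suc-≤ t with orig-step t
  ... | inj₁ (eq , _) = subst (_≤ suc (orig t)) (sym eq) (n≤1+n (orig t))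
  ... | inj₂ (eq , _) = ≤-reflexive eq

  orig-≤-suc : ∀ t → orig t ≤ orig (suc t)
  orig-≤-suc t with orig-step t
  ... | inj₁ (eq , _) = ≤-reflexive (sym eq)
  ... | inj₂ (eq , _) = subst (orig t ≤_) (sym eq) (n≤1+n (orig t))

  orig-mono : ∀ {t t′} → t ≤ t′ → orig t ≤ orig t′
  orig-mono {t′ = zero} z≤n = ≤-refl
  orig-mono {t} {suc t′} t≤t′ with m≤n⇒m<n∨m≡n t≤t′
  ... | inj₁ t<t′ = ≤-trans (orig-mono (≤-pred t<t′)) (orig-≤-suc t′)
  ... | inj₂ refl = ≤-refl

  orig-reflects-< : ∀ {t t′} → orig t < orig t′ → t < t′
  orig-reflects-< {t} {t′} ot<ot′ with t <? t′
  ... | yes t<t′ = t<t′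
  ... | no t≮t′ = contradiction (orig-mono (≮⇒≥ t≮t′)) (<⇒≱ ot<ot′)

  moving-advances : ∀ t → mv′ t ≡ true → orig (suc t) ≡ suc (orig t) × mv (orig t) ≡ true
  moving-advances t mv′t with orig-step t
  ... | inj₁ (_ , mv′t≡false) = contradiction (trans (sym mv′t) mv′t≡false) λ ()
  ... | inj₂ (eq , mv′t≡mv) = eq , trans (sym mv′t≡mv) mv′t

  advancing-moves : ∀ t → orig (suc t) ≡ suc (orig t) → mv′ t ≡ mv (orig t)
  advancing-moves t eq with orig-step t
  ... | inj₁ (eq′ , _) = contradiction (trans (sym eq) eq′) 1+n≢n
  ... | inj₂ (_ , mv′t≡mv) = mv′t≡mv

  last-preimage-from : ∀ {t m} → orig t ≤ m →
                       ∃ λ s → t ≤ s × orig s ≡ m × orig (suc s) ≡ suc m ×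
                               Throughout (λ l → orig l ≤ m) t s
  last-preimage-from {t} {m} ot≤m with orig-onto (suc m)
  ... | tₘ , otₘ with first-entry (λ l → suc m ≤? orig l) (m≤m+n t tₘ) (<⇒≱ (s≤s ot≤m))
                        (subst (_≤ orig (t + tₘ)) otₘ (orig-mono (m≤n+m tₘ t)))
  ...   | s , t≤s , _ , below , m<os+1 =
          s , t≤s , os≡m , os+1≡m+1 , λ l t≤l l≤s → ≤-pred (≰⇒> (below l t≤l l≤s))
    where
    os≤m : orig s ≤ m
    os≤m = ≤-pred (≰⇒> (below s t≤s ≤-refl))
    os+1≡m+1 : orig (suc s) ≡ suc m
    os+1≡m+1 = ≤-antisym (≤-trans (orig-suc-≤ s) (s≤s os≤m)) m<os+1
    os≡m : orig s ≡ m
    os≡m = ≤-antisym os≤m (≤-pred (subst (_≤ suc (orig s)) os+1≡m+1 (orig-suc-≤ s)))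

  first-preimage : ∀ {t m} → orig t ≤ m →
                   ∃ λ t′ → t ≤ t′ × orig t′ ≡ m × (∀ l → t ≤ l → l < t′ → orig l < m)
  first-preimage {t} {m} ot≤m with m≤n⇒m<n∨m≡n ot≤m
  ... | inj₂ ot≡m = t , ≤-refl , ot≡m , λ l t≤l l<t → contradiction l<t (≤⇒≯ t≤l)
  first-preimage {t} {suc m} _ | inj₁ (s≤s ot≤m) with last-preimage-from ot≤m
  ... | s , t≤s , _ , os+1 , below =
        suc s , m≤n⇒m≤1+n t≤s , os+1 , λ l t≤l l<s+1 → s≤s (below l t≤l (≤-pred l<s+1))

  last-preimage : ∀ m → ∃ λ p → orig p ≡ m × orig (suc p) ≡ suc m × (∀ l → orig l ≤ m → l ≤ p)
  last-preimage m with last-preimage-from (subst (_≤ m) (sym orig-zero) z≤n)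
  ... | p , _ , op , op+1 , _ =
        p , op , op+1 , λ l ol≤m → ≤-pred (orig-reflects-< (subst (orig l <_) (sym op+1) (s≤s ol≤m)))

  Invariant : LTL X → Set
  Invariant φ = ∀ t → ⟦ φ ⟧ mv′ w′ t ⇔ ⟦ φ ⟧ mv w (orig t)

  G-invariant : ∀ {φ} → Invariant φ → Invariant (Gₗ φ)
  G-invariant {φ} ih t = mk⇔ forward backward
    where
    forward : ⟦ Gₗ φ ⟧ mv′ w′ t → ⟦ Gₗ φ ⟧ mv w (orig t)
    forward always k ot≤k with first-preimage ot≤k
    ... | t′ , t≤t′ , refl , _ = to (ih t′) (always t′ t≤t′)
    backward : ⟦ Gₗ φ ⟧ mv w (orig t) → ⟦ Gₗ φ ⟧ mv′ w′ t
    backward always k t≤k = from (ih k) (always (orig k) (orig-mono t≤k))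

  U-invariant : ∀ {φ ψ} → Invariant φ → Invariant ψ → Invariant (φ Uₗ ψ)
  U-invariant {φ} {ψ} ihφ ihψ t = mk⇔ forward backward
    where
    forward : ⟦ φ Uₗ ψ ⟧ mv′ w′ t → ⟦ φ Uₗ ψ ⟧ mv w (orig t)
    forward (k , t≤k , ψk , φ-before) = orig k , orig-mono t≤k , to (ihψ k) ψk , φ-before′
      where
      φ-before′ : ∀ l → orig t ≤ l → l < orig k → ⟦ φ ⟧ mv w l
      φ-before′ l ot≤l l<ok with first-preimage ot≤l
      ... | t′ , t≤t′ , refl , _ = to (ihφ t′) (φ-before t′ t≤t′ (orig-reflects-< l<ok))
    backward : ⟦ φ Uₗ ψ ⟧ mv w (orig t) → ⟦ φ Uₗ ψ ⟧ mv′ w′ t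
    backward (k , ot≤k , ψk , φ-before) with first-preimage ot≤k
    ... | t′ , t≤t′ , refl , below =
          t′ , t≤t′ , from (ihψ t′) ψk ,
          λ l t≤l l<t′ → from (ihφ l) (φ-before (orig l) (orig-mono t≤l) (below l t≤l l<t′))

  X-forward : ∀ {φ} → Invariant φ → ∀ t → ⟦ Xₗ φ ⟧ mv′ w′ t → ⟦ Xₗ φ ⟧ mv w (orig t)
  X-forward ih t (k , (k₁ , t≤k₁ , k₁<k , mv′k₁ , mv′k , only-k₁) , φk) =
    orig k , (orig k₁ , orig-mono t≤k₁ , ok₁<ok , proj₂ (moving-advances k₁ mv′k₁) ,
              proj₂ (moving-advances k mv′k) , only-ok₁) , to (ih k) φk
    where
    ok₁<ok : orig k₁ < orig k
    ok₁<ok = subst (_≤ orig k) (proj₁ (moving-advances k₁ mv′k₁)) (orig-mono k₁<k)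
    only-ok₁ : ∀ l → orig t ≤ l → l < orig k → mv l ≡ true → l ≡ orig k₁
    only-ok₁ l ot≤l l<ok mv-l with last-preimage l
    ... | p , refl , op+1 , last = cong orig (only-k₁ p (last t ot≤l) (orig-reflects-< l<ok)
                                                 (trans (advancing-moves p op+1) mv-l))

  X-backward : ∀ {φ} → Invariant φ → ∀ t → ⟦ Xₗ φ ⟧ mv w (orig t) → ⟦ Xₗ φ ⟧ mv′ w′ t
  X-backward ih t (k , (k₁ , ot≤k₁ , k₁<k , mv-k₁ , mv-k , only-k₁) , φk)
    with last-preimage k₁ | last-preimage k
  ... | p₁ , refl , op₁+1 , last₁ | p , refl , op+1 , _ =
    p , (p₁ , last₁ t ot≤k₁ , orig-reflects-< k₁<k , trans (advancing-moves p₁ op₁+1) mv-k₁ ,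
         trans (advancing-moves p op+1) mv-k , only-p₁) , from (ih p) φk
    where
    only-p₁ : ∀ l → t ≤ l → l < p → mv′ l ≡ true → l ≡ p₁
    only-p₁ l t≤l l<p mv′l = ≤-antisym (last₁ l (≤-reflexive ol≡op₁)) p₁≤l
      where
      ol+1≡ : orig (suc l) ≡ suc (orig l)
      ol+1≡ = proj₁ (moving-advances l mv′l)
      ol≡op₁ : orig l ≡ orig p₁
      ol≡op₁ = only-k₁ (orig l) (orig-mono t≤l)
                 (subst (_≤ orig p) ol+1≡ (orig-mono l<p)) (proj₂ (moving-advances l mv′l))
      p₁≤l : p₁ ≤ l
      p₁≤l = ≤-pred (orig-reflects-< (subst (orig p₁ <_) (sym ol+1≡) (s≤s (≤-reflexive (sym ol≡op₁)))))

  stuttering-invariant : ∀ φ → Invariant φ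
  stuttering-invariant trueₗ    t = mk⇔ _ _
  stuttering-invariant (atom a) t = mk⇔ (trans (sym (label-orig t a))) (trans (label-orig t a))
  stuttering-invariant (¬ₗ φ)   t = ¬-cong-⇔ (stuttering-invariant φ t)
  stuttering-invariant (φ ∧ₗ ψ) t = stuttering-invariant φ t ×-⇔ stuttering-invariant ψ t
  stuttering-invariant (φ ∨ₗ ψ) t = stuttering-invariant φ t ⊎-⇔ stuttering-invariant ψ t
  stuttering-invariant (φ ⇒ₗ ψ) t = →-cong-⇔ (stuttering-invariant φ t) (stuttering-invariant ψ t)
  stuttering-invariant (Xₗ φ)   t =
    mk⇔ (X-forward (stuttering-invariant φ) t) (X-backward (stuttering-invariant φ) t)
  stuttering-invariant (Gₗ φ)   t = G-invariant (stuttering-invariant φ) t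
  stuttering-invariant (φ Uₗ ψ) t = U-invariant (stuttering-invariant φ) (stuttering-invariant ψ) t

⟦⟧-mapLTL : ∀ {AP X : Set} (g : AP → X) {mv : ℕ → Bool} {w : ℕ → X → Bool} φ t →
            ⟦ mapLTL g φ ⟧ mv w t ⇔ ⟦ φ ⟧ mv (λ u a → w u (g a)) t
⟦⟧-mapLTL g trueₗ    t = mk⇔ _ _
⟦⟧-mapLTL g (atom a) t = mk⇔ (λ x → x) (λ x → x)
⟦⟧-mapLTL g (¬ₗ φ)   t = ¬-cong-⇔ (⟦⟧-mapLTL g φ t)
⟦⟧-mapLTL g (φ ∧ₗ ψ) t = ⟦⟧-mapLTL g φ t ×-⇔ ⟦⟧-mapLTL g ψ t
⟦⟧-mapLTL g (φ ∨ₗ ψ) t = ⟦⟧-mapLTL g φ t ⊎-⇔ ⟦⟧-mapLTL g ψ t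
⟦⟧-mapLTL g (φ ⇒ₗ ψ) t = →-cong-⇔ (⟦⟧-mapLTL g φ t) (⟦⟧-mapLTL g ψ t)
⟦⟧-mapLTL g (Xₗ φ)   t =
  mk⇔ (λ (k , next , φk) → k , next , to (⟦⟧-mapLTL g φ k) φk)
      (λ (k , next , φk) → k , next , from (⟦⟧-mapLTL g φ k) φk)
⟦⟧-mapLTL g (Gₗ φ)   t =
  mk⇔ (λ always k t≤k → to (⟦⟧-mapLTL g φ k) (always k t≤k))
      (λ always k t≤k → from (⟦⟧-mapLTL g φ k) (always k t≤k))
⟦⟧-mapLTL g (φ Uₗ ψ) t =
  mk⇔ (λ (k , t≤k , ψk , φ-before) → k , t≤k , to (⟦⟧-mapLTL g ψ k) ψk ,
                                      λ l t≤l l<k → to (⟦⟧-mapLTL g φ l) (φ-before l t≤l l<k))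
      (λ (k , t≤k , ψk , φ-before) → k , t≤k , from (⟦⟧-mapLTL g ψ k) ψk ,
                                      λ l t≤l l<k → from (⟦⟧-mapLTL g φ l) (φ-before l t≤l l<k))

ringSucc-cases : ∀ n (x : Fin (suc n)) →
  (x ≡ fromℕ n × ringSucc n x ≡ zero) ⊎ (toℕ x < n × toℕ (ringSucc n x) ≡ suc (toℕ x))
ringSucc-cases zero    zero    = inj₁ (refl , refl)
ringSucc-cases (suc n) zero    = inj₂ (s≤s z≤n , refl)
ringSucc-cases (suc n) (suc i) with ringSucc n i | ringSucc-cases n i
... | zero  | inj₁ (refl , _) = inj₁ (refl , refl)
... | suc _ | inj₂ (i<n , eq) = inj₂ (s≤s i<n , cong suc eq)

ringSucc-fromℕ : ∀ n → ringSucc n (fromℕ n) ≡ zero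
ringSucc-fromℕ n with ringSucc-cases n (fromℕ n)
... | inj₁ (_ , eq) = eq
... | inj₂ (lt , _) = contradiction (toℕ-fromℕ n) (<⇒≢ lt)

ringSucc≡zero : ∀ n (x : Fin (suc n)) → ringSucc n x ≡ zero → x ≡ fromℕ n
ringSucc≡zero n x eq with ringSucc-cases n x
... | inj₁ (x≡last , _) = x≡last
... | inj₂ (_ , eq′) = contradiction (trans (cong toℕ (sym eq)) eq′) 0≢1+n

toℕ-ringSucc : ∀ n (x : Fin (suc n)) → ringSucc n x ≢ zero → toℕ (ringSucc n x) ≡ suc (toℕ x)
toℕ-ringSucc n x ≢zero with ringSucc-cases n x
... | inj₁ (_ , eq) = contradiction eq ≢zero
... | inj₂ (_ , eq) = eq

toℕ-ringSucc-< : ∀ n (x : Fin (suc n)) → toℕ x < n → toℕ (ringSucc n x) ≡ suc (toℕ x)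
toℕ-ringSucc-< n x x<n with ringSucc-cases n x
... | inj₁ (refl , _) = contradiction (toℕ-fromℕ n) (<⇒≢ x<n)
... | inj₂ (_ , eq) = eq

ringSucc-irreflexive : ∀ n (x : Fin (suc (suc n))) → ringSucc (suc n) x ≢ x
ringSucc-irreflexive n x eq with ringSucc-cases (suc n) x
... | inj₁ (refl , eq′) = contradiction (trans (sym eq′) eq) λ ()
... | inj₂ (_ , eq′) = 1+n≢n (trans (sym eq′) (cong toℕ eq))

module Moves {S : Signature} {A B : Template S} {m : ℕ} (r : Ring.Run A B m) where
  open Signature S
  open Ring A B m
  open Run r

  Sends Receives Quiet : Proc → ℕ → Set
  Sends    p u = moving u p ≡ true × outP p (st u p) snd ≡ true × inp u p rcv ≡ false
  Receives p u = moving u p ≡ true × inp u p rcv ≡ true × outP p (st u p) snd ≡ false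
  Quiet    p u = moving u p ≡ true → outP p (st u p) snd ≡ false × inp u p rcv ≡ false

  QuietOn : Proc → ℕ → ℕ → Set
  QuietOn p a b = ∀ u → a ≤ u → u < b → Quiet p u

module Token {S : Signature} {A B : Template S} {n : ℕ} (r : Ring.Run A B (suc n)) where
  open Signature S
  open Ring A B (suc n)
  open Run r
  open Moves r public

  hasTok : ℕ → Proc → Bool
  hasTok u p = Template.hasTok (tmpl p) (st u p)

  holder : ℕ → Proc
  holder zero    = zero
  holder (suc u) with proj₁ (step u)
  ... | inj₁ _       = holder u
  ... | inj₂ (v , _) = ringSucc (suc n) v

  HeldBy : ℕ → Proc → Set
  HeldBy u p = hasTok u p ≡ true × (∀ q → q ≢ p → hasTok u q ≡ false)

  held-by-unique : ∀ {u p q} → HeldBy u p → hasTok u q ≡ true → q ≡ p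
  held-by-unique {u} {p} {q} (_ , others) tq with q ≟ᶠ p
  ... | yes q≡p = q≡p
  ... | no q≢p = contradiction (trans (sym tq) (others q q≢p)) λ ()

  sender-hasTok : ∀ u p → outP p (st u p) snd ≡ true → hasTok u p ≡ true
  sender-hasTok u p = Template.out-snd (tmpl p) (st u p)

  hasTok-quiet : ∀ u p → Quiet p u → hasTok (suc u) p ≡ hasTok u p
  hasTok-quiet u p quiet with moving u p in mv
  ... | false = cong (Template.hasTok (tmpl p)) (proj₂ (proj₂ (step u)) p mv)
  ... | true with hasTok u p in tok | quiet refl
  ...   | true  | ¬snd , ¬rcv = Template.δ-T-nsnd (tmpl p) _ _ _ tok ¬snd ¬rcv (proj₁ (proj₂ (step u)) p mv)
  ...   | false | _    , ¬rcv = Template.δ-NT-nrcv (tmpl p) _ _ _ tok ¬rcv (proj₁ (proj₂ (step u)) p mv)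

  held-by-holder : ∀ u → HeldBy u (holder u)
  held-by-holder zero = subst (λ s → Template.hasTok A s ≡ true) (sym (init zero)) (Template.ιt∈T A) , others
    where
    others : ∀ q → q ≢ zero → hasTok 0 q ≡ false
    others zero    q≢0 = contradiction refl q≢0
    others (suc k) _   = trans (cong (Template.hasTok B) (init (suc k))) (Template.ιn∈NT B)
  held-by-holder (suc u) with proj₁ (step u) | held-by-holder u
  ... | inj₁ internal | tok , others =
        trans (hasTok-quiet u (holder u) (internal (holder u))) tok ,
        λ q q≢h → trans (hasTok-quiet u q (internal q)) (others q q≢h)
  ... | inj₂ (v , snd-v , mv-v , mv-w , rcv-w , others-snd , others-rcv) | held = tok-w , others
    where
    w = ringSucc (suc n) v
    v≡h : v ≡ holder u
    v≡h = held-by-unique held (sender-hasTok u v snd-v)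
    w≢v : w ≢ v
    w≢v = ringSucc-irreflexive n v
    tok-w : hasTok (suc u) w ≡ true
    tok-w = Template.δ-NT-rcv (tmpl w) _ _ _ (proj₂ held w (λ w≡h → w≢v (trans w≡h (sym v≡h)))) rcv-w
              (proj₁ (proj₂ (step u)) w mv-w)
    others : ∀ q → q ≢ w → hasTok (suc u) q ≡ false
    others q q≢w with q ≟ᶠ v
    ... | yes refl = Template.δ-T-snd (tmpl v) _ _ _ (sender-hasTok u v snd-v) snd-v (others-rcv v mv-v q≢w)
                       (proj₁ (proj₂ (step u)) v mv-v)
    ... | no q≢v = trans (hasTok-quiet u q (λ mv-q → others-snd q mv-q q≢v , others-rcv q mv-q q≢w))
                         (proj₂ held q (λ q≡h → q≢v (trans q≡h (sym v≡h))))

  hasTok⇒holder : ∀ u p → hasTok u p ≡ true → p ≡ holder u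
  hasTok⇒holder u p = held-by-unique (held-by-holder u)

  token-passed : ∀ u → holder (suc u) ≢ holder u →
                 holder (suc u) ≡ ringSucc (suc n) (holder u) × Sends (holder u) u × Receives (holder (suc u)) u
  token-passed u changed with proj₁ (step u)
  ... | inj₁ _ = contradiction refl changed
  ... | inj₂ (v , snd-v , mv-v , mv-w , rcv-w , others-snd , others-rcv) =
        subst Passed (hasTok⇒holder u v (sender-hasTok u v snd-v))
          (refl , (mv-v , snd-v , others-rcv v mv-v (λ v≡w → ringSucc-irreflexive n v (sym v≡w))) ,
                  (mv-w , rcv-w , others-snd w mv-w (ringSucc-irreflexive n v)))
    where
    w = ringSucc (suc n) v
    Passed : Proc → Set
    Passed x = w ≡ ringSucc (suc n) x × Sends x u × Receives w u

  holder-step : ∀ u → holder (suc u) ≡ holder u ⊎ holder (suc u) ≡ ringSucc (suc n) (holder u)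
  holder-step u with holder (suc u) ≟ᶠ holder u
  ... | yes same = inj₁ same
  ... | no changed = inj₂ (proj₁ (token-passed u changed))

  sends-on-loss : ∀ p u → holder u ≡ p → holder (suc u) ≢ p → Sends p u
  sends-on-loss p u refl lost = proj₁ (proj₂ (token-passed u lost))

  receives-on-gain : ∀ p u → holder u ≢ p → holder (suc u) ≡ p → Receives p u
  receives-on-gain p u absent refl = proj₂ (proj₂ (token-passed u (λ eq → absent (sym eq))))

  moving-sender-passes : ∀ p u → moving u p ≡ true → outP p (st u p) snd ≡ true →
                         holder (suc u) ≡ ringSucc (suc n) p
  moving-sender-passes p u mv-p snd-p with proj₁ (step u)
  ... | inj₁ internal = contradiction (trans (sym snd-p) (proj₁ (internal p mv-p))) λ ()
  ... | inj₂ (v , _ , _ , _ , _ , others-snd , _) with p ≟ᶠ v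
  ...   | yes refl = refl
  ...   | no p≢v = contradiction (trans (sym snd-p) (others-snd p mv-p p≢v)) λ ()

  moving-receiver-gains : ∀ p u → moving u p ≡ true → inp u p rcv ≡ true →
                          holder u ≢ p × holder (suc u) ≡ p
  moving-receiver-gains p u mv-p rcv-p with proj₁ (step u)
  ... | inj₁ internal = contradiction (trans (sym rcv-p) (proj₂ (internal p mv-p))) λ ()
  ... | inj₂ (v , snd-v , _ , _ , _ , _ , others-rcv) with p ≟ᶠ ringSucc (suc n) v
  ...   | no p≢w = contradiction (trans (sym rcv-p) (others-rcv p mv-p p≢w)) λ ()
  ...   | yes refl = (λ h≡w → ringSucc-irreflexive n v (trans (sym h≡w) (sym v≡h))) , refl
    where
    v≡h : v ≡ holder u
    v≡h = hasTok⇒holder u v (sender-hasTok u v snd-v)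

  quiet-while : ∀ p u → (holder u ≡ p → holder (suc u) ≡ p) → (holder (suc u) ≡ p → holder u ≡ p) →
                Quiet p u
  quiet-while p u keeps stays mv-p with outP p (st u p) snd in snd-p | inp u p rcv in rcv-p
  ... | true | _ =
        contradiction (trans (sym (moving-sender-passes p u mv-p snd-p)) (keeps h≡p)) (ringSucc-irreflexive n p)
    where
    h≡p : holder u ≡ p
    h≡p = sym (hasTok⇒holder u p (sender-hasTok u p snd-p))
  ... | false | true = contradiction (stays (proj₂ gains)) (proj₁ gains)
    where
    gains = moving-receiver-gains p u mv-p rcv-p
  ... | false | false = refl , refl

  quiet-holding : ∀ p u → holder u ≡ p → holder (suc u) ≡ p → Quiet p u
  quiet-holding p u holds holds′ = quiet-while p u (λ _ → holds′) (λ _ → holds)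

  quiet-absent : ∀ p u → holder u ≢ p → holder (suc u) ≢ p → Quiet p u
  quiet-absent p u absent absent′ = quiet-while p u (λ h → contradiction h absent) (λ h → contradiction h absent′)

  quiet-holding-on : ∀ p {a b} → Throughout (λ t → holder t ≡ p) a b → QuietOn p a b
  quiet-holding-on p holds u a≤u u<b =
    quiet-holding p u (holds u a≤u (<⇒≤ u<b)) (holds (suc u) (m≤n⇒m≤1+n a≤u) u<b)

  quiet-absent-on : ∀ p {a b} → Throughout (λ t → holder t ≢ p) a b → QuietOn p a b
  quiet-absent-on p absent u a≤u u<b =
    quiet-absent p u (absent u a≤u (<⇒≤ u<b)) (absent (suc u) (m≤n⇒m≤1+n a≤u) u<b)

  from-last : ∀ u → holder u ≢ zero → holder (suc u) ≡ zero → holder u ≡ fromℕ (suc n)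
  from-last u ¬A A′ with holder-step u
  ... | inj₁ same = contradiction (trans (sym same) A′) ¬A
  ... | inj₂ next = ringSucc≡zero (suc n) (holder u) (trans (sym next) A′)

  last-keeps : ∀ u → holder u ≡ fromℕ (suc n) → holder (suc u) ≢ zero → holder (suc u) ≡ fromℕ (suc n)
  last-keeps u last ¬A′ with holder-step u
  ... | inj₁ same = trans same last
  ... | inj₂ next =
        contradiction (trans next (trans (cong (ringSucc (suc n)) last) (ringSucc-fromℕ (suc n)))) ¬A′

  toℕ-holder-≤-suc : ∀ u → holder (suc u) ≢ zero → toℕ (holder u) ≤ toℕ (holder (suc u))
  toℕ-holder-≤-suc u ¬A′ with holder-step u
  ... | inj₁ same = ≤-reflexive (cong toℕ (sym same))
  ... | inj₂ next = subst (toℕ (holder u) ≤_)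
                      (sym (trans (cong toℕ next) (toℕ-ringSucc (suc n) (holder u) (λ z → ¬A′ (trans next z)))))
                      (n≤1+n _)

  -- the token index only grows until it wraps around through A
  token-passes-A : ∀ {a b} → a ≤ b → toℕ (holder b) < toℕ (holder a) →
                   ∃ λ u → a ≤ u × u ≤ b × holder u ≡ zero
  token-passes-A {b = zero} z≤n hb<ha = contradiction hb<ha (<-irrefl refl)
  token-passes-A {a} {suc b} a≤b+1 hb<ha with holder (suc b) ≟ᶠ zero
  ... | yes at-A = suc b , a≤b+1 , ≤-refl , at-A
  ... | no ¬at-A with m≤n⇒m<n∨m≡n a≤b+1
  ...   | inj₂ refl = contradiction hb<ha (<-irrefl refl)
  ...   | inj₁ a<b+1 with token-passes-A (≤-pred a<b+1) (≤-<-trans (toℕ-holder-≤-suc b ¬at-A) hb<ha)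
  ...     | u , a≤u , u≤b , at-A = u , a≤u , m≤n⇒m≤1+n u≤b , at-A

  toℕ-holder-after-pass : ∀ {p u} → holder u ≡ p → holder (suc u) ≢ p → holder (suc u) ≢ zero →
                          toℕ (holder (suc u)) ≡ suc (toℕ p)
  toℕ-holder-after-pass {p} {u} refl lost ¬A′ =
    trans (cong toℕ passed) (toℕ-ringSucc (suc n) p (λ eq → ¬A′ (trans passed eq)))
    where
    passed = proj₁ (token-passed u lost)

  returns-via-A : ∀ {p j l} → holder j ≡ p → holder (suc j) ≢ p → suc j ≤ l → holder l ≡ p →
                  ∃ λ u → suc j ≤ u × u ≤ l × holder u ≡ zero
  returns-via-A {p} {j} {l} held lost j<l back with holder (suc j) ≟ᶠ zero
  ... | yes A′ = suc j , ≤-refl , j<l , A′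
  ... | no ¬A′ = token-passes-A j<l (subst (_< toℕ (holder (suc j))) (cong toℕ (sym back))
                                       (≤-reflexive (sym (toℕ-holder-after-pass held lost ¬A′))))

  no-return-without-A : ∀ {p j t} → holder j ≡ p → holder (suc j) ≢ p → suc j ≤ t →
                        Throughout (λ u → holder u ≢ zero) (suc j) t → holder t ≢ p
  no-return-without-A held lost j<t absent back with returns-via-A held lost j<t back
  ... | u , j<u , u≤t , A-u = absent u j<u u≤t A-u

  holds-infinitely-often : ∀ p → ⟦ Gₗ (Fₗ (tokOf p)) ⟧ (movesOf p) label 0 →
                           ∀ t → ∃ λ l → t ≤ l × holder l ≡ p
  holds-infinitely-often p always-eventually t with always-eventually t z≤n
  ... | l , t≤l , tok-l , _ =
        l , t≤l , sym (hasTok⇒holder l p (trans (sym (Template.out-tok (tmpl p) (st l p))) tok-l))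

-- Process x of the target ring replays the run of process src x of r under its own clock: a step
-- ticks the clocks of the selected processes, and a selected process moves iff its source did.
module Simulation {S : Signature} {A B : Template S} {m : ℕ} (r : Ring.Run A B m)
                  (n : ℕ) (srcB : Fin n → Fin m) where
  open Signature S
  module Src = Ring A B m
  module Tgt = Ring A B n
  open Src.Run r
  open Moves r

  Clock Movers : Set
  Clock  = Fin (suc n) → ℕ
  Movers = Fin (suc n) → Bool

  src : Fin (suc n) → Fin (suc m)
  src zero    = zero
  src (suc k) = suc (srcB k)

  localState : (x : Fin (suc n)) → ℕ → Tgt.LState x
  localState zero    u = st u zero
  localState (suc k) u = st u (suc (srcB k))

  state : Clock → Tgt.GState
  state c x = localState x (c x)

  input : Clock → Tgt.GInput
  input c x = inp (c x) (src x)

  movesAt : Clock → Movers → Movers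
  movesAt c M x = M x ∧ moving (c x) (src x)

  tick : Movers → Clock → Clock
  tick M c x = if M x then suc (c x) else c x

  Valid : Clock → Movers → Set
  Valid c M = Tgt.Internal (state c) (input c) (movesAt c M) ⊎ Tgt.TokenPass (state c) (input c) (movesAt c M)

  outP-local : ∀ x u o → Tgt.outP x (localState x u) o ≡ Src.outP (src x) (st u (src x)) o
  outP-local zero    u o = refl
  outP-local (suc k) u o = refl

  δ-local : ∀ x u → moving u (src x) ≡ true →
            Tgt.δP x (localState x u) (inp u (src x)) (localState x (suc u)) ≡ true
  δ-local zero    u = proj₁ (proj₂ (step u)) zero
  δ-local (suc k) u = proj₁ (proj₂ (step u)) (suc (srcB k))

  idle-local : ∀ x u → moving u (src x) ≡ false → localState x (suc u) ≡ localState x u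
  idle-local zero    u = proj₂ (proj₂ (step u)) zero
  idle-local (suc k) u = proj₂ (proj₂ (step u)) (suc (srcB k))

  tick-cases : ∀ M c x → (tick M c x ≡ c x × movesAt c M x ≡ false)
                       ⊎ (tick M c x ≡ suc (c x) × movesAt c M x ≡ moving (c x) (src x))
  tick-cases M c x with M x
  ... | false = inj₁ (refl , refl)
  ... | true  = inj₂ (refl , refl)

  tick-step : ∀ c M → Valid c M → Tgt.Step (state c) (input c) (movesAt c M) (state (tick M c))
  tick-step c M valid = valid , moved , idle
    where
    moved : ∀ x → movesAt c M x ≡ true → Tgt.δP x (state c x) (input c x) (state (tick M c) x) ≡ true
    moved x mv with tick-cases M c x
    ... | inj₁ (_ , ¬mv) = contradiction (trans (sym mv) ¬mv) λ ()
    ... | inj₂ (ticked , mv≡) rewrite ticked = δ-local x (c x) (trans (sym mv≡) mv)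
    idle : ∀ x → movesAt c M x ≡ false → state (tick M c) x ≡ state c x
    idle x ¬mv with tick-cases M c x
    ... | inj₁ (same , _) = cong (localState x) same
    ... | inj₂ (ticked , mv≡) rewrite ticked = idle-local x (c x) (trans (sym mv≡) ¬mv)

  moves-selected : ∀ c M x → movesAt c M x ≡ true → M x ≡ true × moving (c x) (src x) ≡ true
  moves-selected c M x mv with M x
  ... | true = refl , mv

  valid-internal : ∀ c M → (∀ x → M x ≡ true → Quiet (src x) (c x)) → Valid c M
  valid-internal c M quiet = inj₁ λ x mv →
    let (Mx , mvx) = moves-selected c M x mv
    in trans (outP-local x (c x) snd) (proj₁ (quiet x Mx mvx)) , proj₂ (quiet x Mx mvx)

  valid-pass : ∀ c M v → M v ≡ true → M (ringSucc n v) ≡ true →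
               (∀ x → M x ≡ true → x ≡ v ⊎ x ≡ ringSucc n v) →
               Sends (src v) (c v) → Receives (src (ringSucc n v)) (c (ringSucc n v)) → Valid c M
  valid-pass c M v Mv Mw only (mv-v , snd-v , rcv-v) (mv-w , rcv-w , snd-w) =
    inj₂ (v , trans (outP-local v (c v) snd) snd-v , mv-sel v Mv mv-v , mv-sel w Mw mv-w , rcv-w ,
          others-snd , others-rcv)
    where
    w = ringSucc n v
    mv-sel : ∀ x → M x ≡ true → moving (c x) (src x) ≡ true → movesAt c M x ≡ true
    mv-sel x Mx mvx rewrite Mx = mvx
    others-snd : ∀ x → movesAt c M x ≡ true → x ≢ v → Tgt.outP x (state c x) snd ≡ false
    others-snd x mv x≢v with only x (proj₁ (moves-selected c M x mv))
    ... | inj₁ x≡v = contradiction x≡v x≢v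
    ... | inj₂ refl = trans (outP-local w (c w) snd) snd-w
    others-rcv : ∀ x → movesAt c M x ≡ true → x ≢ w → input c x rcv ≡ false
    others-rcv x mv x≢w with only x (proj₁ (moves-selected c M x mv))
    ... | inj₁ refl = rcv-v
    ... | inj₂ x≡w = contradiction x≡w x≢w

  only : Fin (suc n) → Movers
  only x y = does (y ≟ᶠ x)

  edge : Fin (suc n) → Movers
  edge v y = does (y ≟ᶠ v) ∨ does (y ≟ᶠ ringSucc n v)

  only-self : ∀ x → only x x ≡ true
  only-self x = dec-true (x ≟ᶠ x) refl

  only-other : ∀ {x y} → y ≢ x → only x y ≡ false
  only-other {x} {y} = dec-false (y ≟ᶠ x)

  only-member : ∀ x y → only x y ≡ true → y ≡ x
  only-member x y sel with y ≟ᶠ x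
  ... | yes y≡x = y≡x

  edge-sender : ∀ v → edge v v ≡ true
  edge-sender v rewrite dec-true (v ≟ᶠ v) refl = refl

  edge-receiver : ∀ v → edge v (ringSucc n v) ≡ true
  edge-receiver v rewrite dec-true (ringSucc n v ≟ᶠ ringSucc n v) refl with ringSucc n v ≟ᶠ v
  ... | yes _ = refl
  ... | no _  = refl

  edge-other : ∀ {v y} → y ≢ v → y ≢ ringSucc n v → edge v y ≡ false
  edge-other {v} {y} y≢v y≢w rewrite dec-false (y ≟ᶠ v) y≢v | dec-false (y ≟ᶠ ringSucc n v) y≢w = refl

  edge-member : ∀ v y → edge v y ≡ true → y ≡ v ⊎ y ≡ ringSucc n v
  edge-member v y sel with y ≟ᶠ v | y ≟ᶠ ringSucc n v
  ... | yes y≡v | _       = inj₁ y≡v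
  ... | no _    | yes y≡w = inj₂ y≡w

  tick-selected : ∀ M c x → M x ≡ true → tick M c x ≡ suc (c x)
  tick-selected M c x sel rewrite sel = refl

  tick-unselected : ∀ M c x → M x ≡ false → tick M c x ≡ c x
  tick-unselected M c x ¬sel rewrite ¬sel = refl

  valid-only : ∀ c x → Quiet (src x) (c x) → Valid c (only x)
  valid-only c x quiet =
    valid-internal c (only x) λ y sel → subst (λ z → Quiet (src z) (c z)) (sym (only-member x y sel)) quiet

  valid-edge-quiet : ∀ c v → Quiet (src v) (c v) → Quiet (src (ringSucc n v)) (c (ringSucc n v)) →
                     Valid c (edge v)
  valid-edge-quiet c v quiet-v quiet-w = valid-internal c (edge v) quiet
    where
    quiet : ∀ y → edge v y ≡ true → Quiet (src y) (c y)
    quiet y sel with edge-member v y sel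
    ... | inj₁ refl = quiet-v
    ... | inj₂ refl = quiet-w

  valid-edge-pass : ∀ c v → Sends (src v) (c v) → Receives (src (ringSucc n v)) (c (ringSucc n v)) →
                    Valid c (edge v)
  valid-edge-pass c v = valid-pass c (edge v) v (edge-sender v) (edge-receiver v) (edge-member v)

  tickAll : List Movers → Clock → Clock
  tickAll []       c = c
  tickAll (M ∷ Ms) c = tickAll Ms (tick M c)

  ValidSeq : Clock → List Movers → Set
  ValidSeq c []       = ⊤
  ValidSeq c (M ∷ Ms) = Valid c M × ValidSeq (tick M c) Ms

  tickAll-++ : ∀ Ms Ns c → tickAll (Ms ++ Ns) c ≡ tickAll Ns (tickAll Ms c)
  tickAll-++ []       Ns c = refl
  tickAll-++ (M ∷ Ms) Ns c = tickAll-++ Ms Ns (tick M c)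

  validSeq-++ : ∀ Ms Ns c → ValidSeq c Ms → ValidSeq (tickAll Ms c) Ns → ValidSeq c (Ms ++ Ns)
  validSeq-++ []       Ns c _           valid-Ns = valid-Ns
  validSeq-++ (M ∷ Ms) Ns c (v , vs) valid-Ns = v , validSeq-++ Ms Ns (tick M c) vs valid-Ns

  tickAll-only-self : ∀ k x c → tickAll (replicate k (only x)) c x ≡ c x + k
  tickAll-only-self zero    x c = sym (+-identityʳ (c x))
  tickAll-only-self (suc k) x c = begin
    tickAll (replicate k (only x)) (tick (only x) c) x ≡⟨ tickAll-only-self k x (tick (only x) c) ⟩
    tick (only x) c x + k                              ≡⟨ cong (_+ k) (tick-selected (only x) c x (only-self x)) ⟩
    suc (c x) + k                                      ≡⟨ sym (+-suc (c x) k) ⟩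
    c x + suc k                                        ∎
    where open ≡-Reasoning

  tickAll-only-other : ∀ k x c {y} → y ≢ x → tickAll (replicate k (only x)) c y ≡ c y
  tickAll-only-other zero    x c y≢x = refl
  tickAll-only-other (suc k) x c y≢x =
    trans (tickAll-only-other k x (tick (only x) c) y≢x) (tick-unselected (only x) c _ (only-other y≢x))

  validSeq-replicate-only : ∀ k x c → QuietOn (src x) (c x) (c x + k) → ValidSeq c (replicate k (only x))
  validSeq-replicate-only zero    x c _     = tt
  validSeq-replicate-only (suc k) x c quiet =
    valid-only c x (quiet (c x) ≤-refl (m<m+n (c x) z<s)) ,
    validSeq-replicate-only k x (tick (only x) c) quiet′
    where
    quiet′ : QuietOn (src x) (tick (only x) c x) (tick (only x) c x + k)
    quiet′ = subst (λ e → QuietOn (src x) e (e + k)) (sym (tick-selected (only x) c x (only-self x)))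
               λ u x<u u<x+k → quiet u (<⇒≤ x<u) (subst (u <_) (sym (+-suc (c x) k)) u<x+k)

  catchUp : Fin (suc n) → ℕ → Clock → List Movers
  catchUp x e c = replicate (e ∸ c x) (only x)

  catchUp-self : ∀ x {e} c → c x ≤ e → tickAll (catchUp x e c) c x ≡ e
  catchUp-self x c cx≤e = trans (tickAll-only-self _ x c) (m+[n∸m]≡n cx≤e)

  catchUp-other : ∀ x e c {y} → y ≢ x → tickAll (catchUp x e c) c y ≡ c y
  catchUp-other x e c = tickAll-only-other (e ∸ c x) x c

  validSeq-catchUp : ∀ x {e} c → c x ≤ e → QuietOn (src x) (c x) e → ValidSeq c (catchUp x e c)
  validSeq-catchUp x c cx≤e quiet =
    validSeq-replicate-only _ x c (subst (QuietOn (src x) (c x)) (sym (m+[n∸m]≡n cx≤e)) quiet)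

  Block : Set
  Block = List Movers × Movers

  tickBlock : Block → Clock → Clock
  tickBlock (Ms , M) c = tick M (tickAll Ms c)

  ValidBlock : Clock → Block → Set
  ValidBlock c (Ms , M) = ValidSeq c Ms × Valid (tickAll Ms c) M

  Extension : (ℕ → Clock → Set) → ℕ → Clock → Set
  Extension Inv j c = Σ Block λ b → ValidBlock c b × Inv (suc j) (tickBlock b c)

  module Construction (Inv : ℕ → Clock → Set) (inv-zero : Inv 0 (λ _ → 0))
    (extend : ∀ j c → Inv j c → Extension Inv j c) where

    record Cfg : Set where
      constructor cfg
      field
        index   : ℕ
        clock   : Clock
        pending : List Movers
        final   : Movers
        valid   : ValidBlock clock (pending , final)
        inv     : Inv (suc index) (tickBlock (pending , final) clock)
    open Cfg

    start : ∀ j c → Inv j c → Cfg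
    start j c iv = cfg j c (proj₁ (proj₁ e)) (proj₂ (proj₁ e)) (proj₁ (proj₂ e)) (proj₂ (proj₂ e))
      where e = extend j c iv

    next : Cfg → Cfg
    next (cfg j c []       M _                  iv) = start (suc j) (tick M c) iv
    next (cfg j c (M′ ∷ Ms) M ((v , vs) , vM) iv) = cfg j (tick M′ c) Ms M (vs , vM) iv

    current : Cfg → Movers
    current (cfg _ _ []       M _ _) = M
    current (cfg _ _ (M′ ∷ _) _ _ _) = M′

    current-valid : ∀ x → Valid (clock x) (current x)
    current-valid (cfg _ _ []       _ (_ , vM)       _) = vM
    current-valid (cfg _ _ (_ ∷ _) _ ((v , _) , _) _) = v

    clock-next : ∀ x → clock (next x) ≡ tick (current x) (clock x)
    clock-next (cfg _ _ []       _ _ _) = refl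
    clock-next (cfg _ _ (_ ∷ _) _ _ _) = refl

    conf : ℕ → Cfg
    conf zero    = start 0 (λ _ → 0) inv-zero
    conf (suc t) = next (conf t)

    step-conf : ∀ t → Tgt.Step (state (clock (conf t))) (input (clock (conf t)))
                               (movesAt (clock (conf t)) (current (conf t))) (state (clock (conf (suc t))))
    step-conf t = subst (λ c′ → Tgt.Step (state c) (input c) (movesAt c M) (state c′))
                        (sym (clock-next (conf t)))
                    (tick-step c M (current-valid (conf t)))
      where
      c = clock (conf t)
      M = current (conf t)

    init-state : ∀ x → state (λ _ → 0) x ≡ Tgt.initState x
    init-state zero    = init zero
    init-state (suc k) = init (suc (srcB k))

    run : Tgt.Run
    run = record
      { st     = λ t → state (clock (conf t))
      ; inp    = λ t → input (clock (conf t))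
      ; moving = λ t → movesAt (clock (conf t)) (current (conf t))
      ; init   = init-state
      ; step   = step-conf
      }

    block-end : ∀ t j c Ms M valid iv → conf t ≡ cfg j c Ms M valid iv →
                conf (t + suc (length Ms)) ≡ start (suc j) (tickBlock (Ms , M) c) iv
    block-end t j c []       M valid iv eq = trans (cong conf (+-comm t 1)) (cong next eq)
    block-end t j c (M′ ∷ Ms) M ((v , vs) , vM) iv eq =
      trans (cong conf (+-suc t (suc (length Ms))))
            (block-end (suc t) j (tick M′ c) Ms M (vs , vM) iv (cong next eq))

    block-start : ∀ j → ∃ λ t → ∃ λ c → Σ (Inv j c) λ iv → conf t ≡ start j c iv
    block-start zero = 0 , _ , inv-zero , refl
    block-start (suc j) with block-start j
    ... | t , c , iv , eq = t + suc (length (pending x)) , _ , inv x ,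
                            block-end t j c (pending x) (final x) (valid x) (inv x) eq
      where x = start j c iv

    view : ∀ p → (∀ j c → Inv j c → c p ≡ j) →
           Stuttering (Tgt.Run.movesOf run p) (λ t a → Tgt.Run.label run t (p , a))
                      (movesOf (src p)) (λ u a → label u (src p , a))
    view p clocked = record
      { orig       = orig
      ; orig-zero  = refl
      ; orig-step  = orig-step
      ; label-orig = label-orig
      ; orig-onto  = orig-onto
      }
      where
      orig : ℕ → ℕ
      orig t = clock (conf t) p
      orig-step : ∀ t → (orig (suc t) ≡ orig t × Tgt.Run.movesOf run p t ≡ false)
                      ⊎ (orig (suc t) ≡ suc (orig t) × Tgt.Run.movesOf run p t ≡ moving (orig t) (src p))
      orig-step t with tick-cases (current (conf t)) (clock (conf t)) p
      ... | inj₁ (same , idle)  = inj₁ (trans (cong (λ c → c p) (clock-next (conf t))) same , idle)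
      ... | inj₂ (ticked , mv) = inj₂ (trans (cong (λ c → c p) (clock-next (conf t))) ticked , mv)
      label-orig : ∀ t a → Tgt.Run.label run t (p , a) ≡ label (orig t) (src p , a)
      label-orig t (inj₁ i) = refl
      label-orig t (inj₂ o) = outP-local p (orig t) o
      orig-onto : ∀ j → ∃ λ t → orig t ≡ j
      orig-onto j with block-start j
      ... | t , c , iv , eq = t , trans (cong (λ x → clock x p) eq) (clocked j c iv)

module MergeOntoA {S : Signature} {A B : Template S} {k : ℕ} (r : Ring.Run A B (suc k))
                  (A-recurs : ∀ t → ∃ λ l → t ≤ l × Token.holder r l ≡ zero) where
  open Token r
  open Simulation r 1 (λ _ → fromℕ k)

  last : Fin (suc (suc k))
  last = fromℕ (suc k)

  b₁ : Fin 2
  b₁ = suc zero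

  last≢A : last ≢ zero
  last≢A ()

  HoldsA WaitsA : ℕ → ℕ → Set
  HoldsA j e = e ≤ j × Throughout (λ t → holder t ≡ zero) e j
  WaitsA j e = holder j ≢ zero × holder e ≡ last × (∀ t → j ≤ t → t < e → holder t ≢ zero) ×
               Throughout (λ t → holder t ≡ last) e j

  Inv : ℕ → Clock → Set
  Inv j c = c zero ≡ j × (HoldsA j (c b₁) ⊎ WaitsA j (c b₁))

  waits-extend : ∀ {j e} → WaitsA j e → holder (suc j) ≢ zero → WaitsA (suc j) e
  waits-extend {j} {e} (_ , last-e , absent , holds) ¬A′ =
    ¬A′ , last-e , (λ t j+1≤t → absent t (≤-trans (n≤1+n j) j+1≤t)) , holds′
    where
    holds′ : Throughout (λ t → holder t ≡ last) e (suc j)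
    holds′ t e≤t t≤j+1 with m≤n⇒m<n∨m≡n t≤j+1
    ... | inj₁ t<j+1 = holds t e≤t (≤-pred t<j+1)
    ... | inj₂ refl with m≤n⇒m<n∨m≡n e≤t
    ...   | inj₁ e<j+1 = last-keeps j (holds j (≤-pred e<j+1) ≤-refl) ¬A′
    ...   | inj₂ refl  = last-e

  waits-lag : ∀ {j e} → WaitsA j e → holder (suc j) ≡ zero → e ≤ j
  waits-lag {j} {e} (_ , last-e , absent , _) A′ with e ≤? j
  ... | yes e≤j = e≤j
  ... | no e≰j with m≤n⇒m<n∨m≡n (≰⇒> e≰j)
  ...   | inj₁ j+1<e = contradiction A′ (absent (suc j) (n≤1+n j) j+1<e)
  ...   | inj₂ refl  = contradiction (trans (sym last-e) A′) last≢A

  A-sends : ∀ j c → c zero ≡ j → HoldsA j (c b₁) → holder j ≡ zero → holder (suc j) ≢ zero →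
            Extension Inv j c
  -- The token comes back to A from the last B at s; before that, the last B receives it at q.
  A-sends j c c0 (e≤j , holds) A ¬A′ with A-recurs (suc j)
  ... | _ , j<l , A-l with first-entry (λ t → holder t ≟ᶠ zero) j<l ¬A′ A-l
  ... | s , j<s , _ , absent-A , A-s+1
      with first-entry (λ t → holder t ≟ᶠ last) (≤-trans e≤j (<⇒≤ j<s))
             (λ eq → last≢A (trans (sym eq) (holds (c b₁) ≤-refl e≤j)))
             (from-last s (absent-A s j<s ≤-refl) A-s+1)
  ... | q , e≤q , q<s , absent-last , last-q+1 =
    (catchUp b₁ q c , edge zero) , (validSeq-catchUp b₁ c e≤q (quiet-absent-on last absent-last) , pass) , inv′
    where
    c′ = tickAll (catchUp b₁ q c) c
    c′0 : c′ zero ≡ j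
    c′0 = trans (catchUp-other b₁ q c λ ()) c0
    c′b : c′ b₁ ≡ q
    c′b = catchUp-self b₁ c e≤q
    pass : Valid c′ (edge zero)
    pass = valid-edge-pass c′ zero (subst (Sends zero) (sym c′0) (sends-on-loss zero j A ¬A′))
             (subst (Receives last) (sym c′b) (receives-on-gain last q (absent-last q e≤q ≤-refl) last-q+1))
    j≤q : j ≤ q
    j≤q with j ≤? q
    ... | yes j≤q = j≤q
    ... | no j≰q = contradiction (trans (sym last-q+1) (holds (suc q) (m≤n⇒m≤1+n e≤q) (≰⇒> j≰q))) last≢A
    waits : WaitsA (suc j) (suc q)
    waits = ¬A′ , last-q+1 , (λ t j+1≤t t≤q → absent-A t j+1≤t (≤-trans (≤-pred t≤q) (<⇒≤ q<s))) ,
            λ t q+1≤t t≤j+1 →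
              subst (λ x → holder x ≡ last) (≤-antisym q+1≤t (≤-trans t≤j+1 (s≤s j≤q))) last-q+1
    inv′ : Inv (suc j) (tick (edge zero) c′)
    inv′ = cong suc c′0 , inj₂ (subst (WaitsA (suc j) ∘ suc) (sym c′b) waits)

  A-receives : ∀ j c → c zero ≡ j → WaitsA j (c b₁) → holder j ≢ zero → holder (suc j) ≡ zero →
               Extension Inv j c
  A-receives j c c0 waits@(_ , _ , _ , holds-last) ¬A A′ =
    (catchUp b₁ j c , edge b₁) , (validSeq-catchUp b₁ c e≤j (quiet-holding-on last holds-last) , pass) , inv′
    where
    e≤j : c b₁ ≤ j
    e≤j = waits-lag waits A′
    c′ = tickAll (catchUp b₁ j c) c
    c′0 : c′ zero ≡ j
    c′0 = trans (catchUp-other b₁ j c λ ()) c0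
    c′b : c′ b₁ ≡ j
    c′b = catchUp-self b₁ c e≤j
    pass : Valid c′ (edge b₁)
    pass = valid-edge-pass c′ b₁
             (subst (Sends last) (sym c′b)
               (sends-on-loss last j (holds-last j e≤j ≤-refl) (λ eq → last≢A (trans (sym eq) A′))))
             (subst (Receives zero) (sym c′0) (receives-on-gain zero j ¬A A′))
    inv′ : Inv (suc j) (tick (edge b₁) c′)
    inv′ = cong suc c′0 , inj₁ (subst (HoldsA (suc j) ∘ suc) (sym c′b) (≤-refl , throughout-single A′))

  extend : ∀ j c → Inv j c → Extension Inv j c
  extend j c (c0 , phase) with holder j ≟ᶠ zero | holder (suc j) ≟ᶠ zero | phase
  ... | yes A | yes A′ | inj₁ (e≤j , holds) =
        ([] , only zero) , (tt , valid-only c zero (subst (Quiet zero) (sym c0) (quiet-holding zero j A A′))) ,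
        cong suc c0 , inj₁ (m≤n⇒m≤1+n e≤j , throughout-extend holds A′)
  ... | no ¬A | no ¬A′ | inj₂ waits =
        ([] , only zero) , (tt , valid-only c zero (subst (Quiet zero) (sym c0) (quiet-absent zero j ¬A ¬A′))) ,
        cong suc c0 , inj₂ (waits-extend waits ¬A′)
  ... | yes A | no ¬A′ | inj₁ holds = A-sends j c c0 holds A ¬A′
  ... | no ¬A | yes A′ | inj₂ waits = A-receives j c c0 waits ¬A A′
  ... | yes A | _      | inj₂ waits = contradiction A (proj₁ waits)
  ... | no ¬A | _      | inj₁ holds = contradiction (proj₂ holds j (proj₁ holds) ≤-refl) ¬A

  inv-zero : Inv 0 (λ _ → 0)
  inv-zero = refl , inj₁ (z≤n , throughout-single refl)

  open Construction Inv inv-zero extend public using (run; view)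

module MergeOntoB {S : Signature} {A B : Template S} {k : ℕ} (r : Ring.Run A B (suc k)) (i : Fin (suc k))
                  (P-recurs : ∀ t → ∃ λ l → t ≤ l × Token.holder r l ≡ suc i) where
  open Token r
  open Simulation r 1 (λ _ → i)

  P : Fin (suc (suc k))
  P = suc i

  b₁ : Fin 2
  b₁ = suc zero

  P≢A : P ≢ zero
  P≢A ()

  HoldsP WaitsP : ℕ → ℕ → Set
  HoldsP j a = holder j ≡ P × a ≤ j × holder a ≢ zero
  WaitsP j a = holder j ≢ P × holder a ≡ zero × (∀ t → j ≤ t → t < a → holder t ≢ P)

  Inv : ℕ → Clock → Set
  Inv j c = c b₁ ≡ j × (HoldsP j (c zero) ⊎ WaitsP j (c zero))

  waits-lag : ∀ {j a} → WaitsP j a → holder (suc j) ≡ P → a ≤ j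
  waits-lag {j} {a} (_ , A-a , absent) P′ with a ≤? j
  ... | yes a≤j = a≤j
  ... | no a≰j with m≤n⇒m<n∨m≡n (≰⇒> a≰j)
  ...   | inj₁ j+1<a = contradiction P′ (absent (suc j) (n≤1+n j) j+1<a)
  ...   | inj₂ refl  = contradiction (trans (sym P′) A-a) P≢A

  P-sends : ∀ j c → c b₁ ≡ j → HoldsP j (c zero) → holder (suc j) ≢ P → Extension Inv j c
  P-sends j c c1 (P-j , a≤j , ¬A-a) ¬P′ with P-recurs (suc j)
  ... | _ , j<l , P-l with returns-via-A P-j ¬P′ j<l P-l
  ... | u , j<u , _ , A-u with first-entry (λ t → holder t ≟ᶠ zero) (≤-trans a≤j (<⇒≤ j<u)) ¬A-a A-u
  ... | q , a≤q , _ , absent-A , A-q+1 =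
    (catchUp zero q c , edge b₁) , (validSeq-catchUp zero c a≤q (quiet-absent-on zero absent-A) , pass) , inv′
    where
    c′ = tickAll (catchUp zero q c) c
    c′1 : c′ b₁ ≡ j
    c′1 = trans (catchUp-other zero q c λ ()) c1
    c′0 : c′ zero ≡ q
    c′0 = catchUp-self zero c a≤q
    pass : Valid c′ (edge b₁)
    pass = valid-edge-pass c′ b₁ (subst (Sends P) (sym c′1) (sends-on-loss P j P-j ¬P′))
             (subst (Receives zero) (sym c′0) (receives-on-gain zero q (absent-A q a≤q ≤-refl) A-q+1))
    absent-P : ∀ t → suc j ≤ t → t < suc q → holder t ≢ P
    absent-P t j<t t≤q = no-return-without-A P-j ¬P′ j<t
                           (λ v j<v v≤t → absent-A v (≤-trans a≤j (<⇒≤ j<v)) (≤-trans v≤t (≤-pred t≤q)))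
    inv′ : Inv (suc j) (tick (edge b₁) c′)
    inv′ = cong suc c′1 , inj₂ (subst (WaitsP (suc j) ∘ suc) (sym c′0) (¬P′ , A-q+1 , absent-P))

  P-receives : ∀ j c → c b₁ ≡ j → WaitsP j (c zero) → holder (suc j) ≡ P → Extension Inv j c
  P-receives j c c1 waits@(¬P , A-a , _) P′
    with first-exit (λ t → holder t ≟ᶠ zero) (m≤n⇒m≤1+n (waits-lag waits P′)) A-a
           (λ eq → P≢A (trans (sym P′) eq))
  ... | s , a≤s , s<j+1 , holds-A , ¬A-s+1 =
    (catchUp zero s c , edge zero) , (validSeq-catchUp zero c a≤s (quiet-holding-on zero holds-A) , pass) , inv′
    where
    c′ = tickAll (catchUp zero s c) c
    c′1 : c′ b₁ ≡ j
    c′1 = trans (catchUp-other zero s c λ ()) c1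
    c′0 : c′ zero ≡ s
    c′0 = catchUp-self zero c a≤s
    pass : Valid c′ (edge zero)
    pass = valid-edge-pass c′ zero
             (subst (Sends zero) (sym c′0) (sends-on-loss zero s (holds-A s a≤s ≤-refl) ¬A-s+1))
             (subst (Receives P) (sym c′1) (receives-on-gain P j ¬P P′))
    inv′ : Inv (suc j) (tick (edge zero) c′)
    inv′ = cong suc c′1 , inj₁ (subst (HoldsP (suc j) ∘ suc) (sym c′0) (P′ , s<j+1 , ¬A-s+1))

  extend : ∀ j c → Inv j c → Extension Inv j c
  extend j c (c1 , phase) with holder j ≟ᶠ P | holder (suc j) ≟ᶠ P | phase
  ... | yes P-j | yes P′ | inj₁ (_ , a≤j , ¬A-a) =
        ([] , only b₁) , (tt , valid-only c b₁ (subst (Quiet P) (sym c1) (quiet-holding P j P-j P′))) ,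
        cong suc c1 , inj₁ (P′ , m≤n⇒m≤1+n a≤j , ¬A-a)
  ... | no ¬P | no ¬P′ | inj₂ (_ , A-a , absent) =
        ([] , only b₁) , (tt , valid-only c b₁ (subst (Quiet P) (sym c1) (quiet-absent P j ¬P ¬P′))) ,
        cong suc c1 , inj₂ (¬P′ , A-a , λ t j<t → absent t (<⇒≤ j<t))
  ... | yes _   | no ¬P′ | inj₁ holds = P-sends j c c1 holds ¬P′
  ... | no _    | yes P′ | inj₂ waits = P-receives j c c1 waits P′
  ... | yes P-j | _      | inj₂ waits = contradiction P-j (proj₁ waits)
  ... | no ¬P   | _      | inj₁ holds = contradiction (proj₁ holds) ¬P

  inv-zero : Inv 0 (λ _ → 0)
  inv-zero = refl , inj₂ ((λ eq → P≢A (sym eq)) , refl , λ t _ t<0 → contradiction t<0 λ ())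

  open Construction Inv inv-zero extend public using (run; view)

module Expand {S : Signature} {A B : Template S} (r : Ring.Run A B 1) (k : ℕ) where
  open Token r
  open Simulation r (suc k) (λ _ → zero)

  b : Fin 2
  b = suc zero

  b₁ : Fin (suc (suc k))
  b₁ = suc zero

  A≢B : zero ≢ b
  A≢B ()

  not-A : ∀ t → holder t ≢ zero → holder t ≡ b
  not-A t ¬A with holder t
  ... | zero     = contradiction refl ¬A
  ... | suc zero = refl

  src-≢zero : ∀ x → x ≢ zero → src x ≡ b
  src-≢zero zero    x≢0 = contradiction refl x≢0
  src-≢zero (suc _) _   = refl

  tick-edge-other : ∀ v c {y} → y ≢ v → y ≢ ringSucc (suc k) v → tick (edge v) c y ≡ c y
  tick-edge-other v c y≢v y≢w = tick-unselected (edge v) c _ (edge-other y≢v y≢w)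

  module Chain {L S R : ℕ} (L≤S : L ≤ S) (S<R : S < R)
               (absent : QuietOn b L S) (receives : Receives b S)
               (present : QuietOn b (suc S) R) (sends : Sends b R) where

    ChainState : Fin (suc (suc k)) → Clock → Set
    ChainState v c = c zero ≡ R × (∀ x → x ≢ zero → toℕ x < toℕ v → c x ≡ suc R) ×
                     c v ≡ R × (∀ x → toℕ v < toℕ x → c x ≡ L)

    -- While B hands the token to A at R, the copy w after v replays B since L: it idles up to S,
    -- receives the token from v where B received it from A, and holds it up to R.
    segment : Fin (suc (suc k)) → Clock → List Movers
    segment v c = catchUp w S c ++ edge v ∷ catchUp w R (tick (edge v) (tickAll (catchUp w S c) c))
      where w = ringSucc (suc k) v

    module Segment (v : Fin (suc (suc k))) (v≢0 : v ≢ zero) (v<n : toℕ v < suc k)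
                   (c : Clock) (cs : ChainState v c) where
      w = ringSucc (suc k) v
      toℕw : toℕ w ≡ suc (toℕ v)
      toℕw = toℕ-ringSucc-< (suc k) v v<n
      v≢w : v ≢ w
      v≢w v≡w = ringSucc-irreflexive k v (sym v≡w)
      w≢0 : w ≢ zero
      w≢0 w≡0 = 0≢1+n (trans (cong toℕ (sym w≡0)) toℕw)
      cw : c w ≡ L
      cw = proj₂ (proj₂ (proj₂ cs)) w (subst (toℕ v <_) (sym toℕw) ≤-refl)
      c₁ = tickAll (catchUp w S c) c
      c₂ = tick (edge v) c₁
      c₃ = tickAll (catchUp w R c₂) c₂
      c₁w : c₁ w ≡ S
      c₁w = catchUp-self w c (subst (_≤ S) (sym cw) L≤S)
      c₁v : c₁ v ≡ R
      c₁v = trans (catchUp-other w S c v≢w) (proj₁ (proj₂ (proj₂ cs)))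
      c₂w : c₂ w ≡ suc S
      c₂w = trans (tick-selected (edge v) c₁ w (edge-receiver v)) (cong suc c₁w)
      c₃w : c₃ w ≡ R
      c₃w = catchUp-self w c₂ (subst (_≤ R) (sym c₂w) S<R)
      c₃v : c₃ v ≡ suc R
      c₃v = trans (catchUp-other w R c₂ v≢w)
                  (trans (tick-selected (edge v) c₁ v (edge-sender v)) (cong suc c₁v))
      c₃-other : ∀ y → y ≢ v → y ≢ w → c₃ y ≡ c y
      c₃-other y y≢v y≢w = trans (catchUp-other w R c₂ y≢w)
                             (trans (tick-edge-other v c₁ y≢v y≢w) (catchUp-other w S c y≢w))
      c₃≡ : tickAll (segment v c) c ≡ c₃
      c₃≡ = tickAll-++ (catchUp w S c) (edge v ∷ catchUp w R c₂) c

      valid : ValidSeq c (segment v c)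
      valid = validSeq-++ (catchUp w S c) (edge v ∷ catchUp w R c₂) c
                (validSeq-catchUp w c (subst (_≤ S) (sym cw) L≤S)
                  (subst₂ (λ p e → QuietOn p e S) (sym (src-≢zero w w≢0)) (sym cw) absent))
                (valid-edge-pass c₁ v (subst₂ Sends (sym (src-≢zero v v≢0)) (sym c₁v) sends)
                   (subst₂ Receives (sym (src-≢zero w w≢0)) (sym c₁w) receives) ,
                 validSeq-catchUp w c₂ (subst (_≤ R) (sym c₂w) S<R)
                   (subst₂ (λ p e → QuietOn p e R) (sym (src-≢zero w w≢0)) (sym c₂w) present))

      state′ : ChainState w c₃
      state′ = c₃0 , passed , c₃w , waiting
        where
        c₃0 : c₃ zero ≡ R
        c₃0 = trans (c₃-other zero (λ 0≡v → v≢0 (sym 0≡v)) (λ 0≡w → w≢0 (sym 0≡w))) (proj₁ cs)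
        passed : ∀ x → x ≢ zero → toℕ x < toℕ w → c₃ x ≡ suc R
        passed x x≢0 x<w with m≤n⇒m<n∨m≡n (≤-pred (subst (toℕ x <_) toℕw x<w))
        ... | inj₂ x≡v = subst (λ y → c₃ y ≡ suc R) (sym (toℕ-injective x≡v)) c₃v
        ... | inj₁ x<v = trans (c₃-other x (λ x≡v → <⇒≢ x<v (cong toℕ x≡v))
                                          (λ x≡w → <⇒≢ x<w (cong toℕ x≡w)))
                               (proj₁ (proj₂ cs) x x≢0 x<v)
        waiting : ∀ x → toℕ w < toℕ x → c₃ x ≡ L
        waiting x w<x = trans (c₃-other x (λ x≡v → <⇒≢ v<x (cong toℕ (sym x≡v)))
                                         (λ x≡w → <⇒≢ w<x (cong toℕ (sym x≡w))))
                              (proj₂ (proj₂ (proj₂ cs)) x v<x)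
          where
          v<x : toℕ v < toℕ x
          v<x = <-trans (subst (toℕ v <_) (sym toℕw) ≤-refl) w<x

    chain : ℕ → Fin (suc (suc k)) → Clock → List Movers
    chain zero    v c = []
    chain (suc m) v c = segment v c ++ chain m (ringSucc (suc k) v) (tickAll (segment v c) c)

    chain-run : ∀ m v c → v ≢ zero → toℕ v + m ≡ suc k → ChainState v c →
                ValidSeq c (chain m v c) × ChainState (fromℕ (suc k)) (tickAll (chain m v c) c)
    chain-run zero v c v≢0 v+0≡n cs = tt , subst (λ x → ChainState x c) v≡last cs
      where
      v≡last : v ≡ fromℕ (suc k)
      v≡last = toℕ-injective (trans (trans (sym (+-identityʳ _)) v+0≡n) (sym (toℕ-fromℕ (suc k))))
    chain-run (suc m) v c v≢0 v+m+1≡n cs =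
      validSeq-++ (segment v c) (chain m w c′) c valid (proj₁ rest) ,
      subst (ChainState (fromℕ (suc k))) (sym (tickAll-++ (segment v c) (chain m w c′) c)) (proj₂ rest)
      where
      v<n : toℕ v < suc k
      v<n = subst (toℕ v <_) v+m+1≡n (m<m+n (toℕ v) z<s)
      open Segment v v≢0 v<n c cs
      c′ = tickAll (segment v c) c
      rest = chain-run m w c′ w≢0
               (trans (cong (_+ m) toℕw) (trans (sym (+-suc (toℕ v) m)) v+m+1≡n))
               (subst (ChainState w) (sym c₃≡) state′)

    module Final (A-receives : Receives zero R) (c : Clock) (cs : ChainState (fromℕ (suc k)) c) where
      last = fromℕ (suc k)
      c0     = proj₁ cs
      passed = proj₁ (proj₂ cs)
      cl     = proj₁ (proj₂ (proj₂ cs))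

      last→A : ringSucc (suc k) last ≡ zero
      last→A = ringSucc-fromℕ (suc k)

      valid : Valid c (edge last)
      valid = valid-edge-pass c last (subst (Sends b) (sym cl) sends)
                (subst (λ x → Receives (src x) (c x)) (sym last→A) (subst (Receives zero) (sym c0) A-receives))

      all-passed : ∀ y → tick (edge last) c y ≡ suc R
      all-passed y with y ≟ᶠ zero
      ... | yes refl = trans (tick-selected (edge last) c zero
                               (subst (λ x → edge last x ≡ true) last→A (edge-receiver last)))
                             (cong suc c0)
      ... | no y≢0 with m≤n⇒m<n∨m≡n (≤-pred (toℕ<n y))
      ...   | inj₂ y≡n = subst (λ x → tick (edge last) c x ≡ suc R) (sym y≡last)
                           (trans (tick-selected (edge last) c last (edge-sender last)) (cong suc cl))
        where
        y≡last : y ≡ last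
        y≡last = toℕ-injective (trans y≡n (sym (toℕ-fromℕ (suc k))))
      ...   | inj₁ y<n = trans (tick-edge-other last c
                                   (λ y≡l → <⇒≢ y<n (trans (cong toℕ y≡l) (toℕ-fromℕ (suc k))))
                                                      (λ y≡0 → y≢0 (trans y≡0 last→A)))
                               (passed y y≢0 (subst (toℕ y <_) (sym (toℕ-fromℕ (suc k))) y<n))

  HoldsA HoldsB : ℕ → ℕ → Set
  HoldsA j L = L ≤ j × Throughout (λ t → holder t ≡ zero) L j
  HoldsB j L = ∃ λ S → L ≤ S × S < j × Throughout (λ t → holder t ≡ zero) L S ×
                       Throughout (λ t → holder t ≡ b) (suc S) j

  Inv : ℕ → Clock → Set
  Inv j c = c zero ≡ j × c b₁ ≡ j × ∃ λ L → (∀ y → c (suc (suc y)) ≡ L) × (HoldsA j L ⊎ HoldsB j L)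

  lockstep : ∀ j c L → c zero ≡ j → c b₁ ≡ j → (∀ y → c (suc (suc y)) ≡ L) →
             Valid c (edge zero) → HoldsA (suc j) L ⊎ HoldsB (suc j) L → Extension Inv j c
  lockstep j c L c0 c1 rest valid phase′ =
    ([] , edge zero) , (tt , valid) , cong suc c0 , cong suc c1 , L , rest , phase′

  B-sends : ∀ j c L → c zero ≡ j → c b₁ ≡ j → (∀ y → c (suc (suc y)) ≡ L) → HoldsB j L →
            holder j ≢ zero → holder (suc j) ≡ zero → Extension Inv j c
  B-sends j c L c0 c1 rest (S , L≤S , S<j , holds-A , holds-B) ¬A A′ =
    (chain k b₁ c , edge (fromℕ (suc k))) , (proj₁ chained , Final.valid A-receives c′ (proj₂ chained)) , inv′
    where
    B-absent : Throughout (λ t → holder t ≢ b) L S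
    B-absent t L≤t t≤S B-t = A≢B (trans (sym (holds-A t L≤t t≤S)) B-t)
    open Chain L≤S S<j (quiet-absent-on b B-absent)
                (receives-on-gain b S (B-absent S L≤S ≤-refl) (holds-B (suc S) ≤-refl S<j))
                (quiet-holding-on b holds-B)
                (sends-on-loss b j (holds-B j S<j ≤-refl) (λ eq → A≢B (trans (sym A′) eq)))
    A-receives : Receives zero j
    A-receives = receives-on-gain zero j ¬A A′
    start : ChainState b₁ c
    start = c0 , (λ { zero x≢0 _ → contradiction refl x≢0 ; (suc _) _ (s≤s ()) }) , c1 ,
            λ { (suc (suc y)) _ → rest y ; (suc zero) (s≤s ()) }
    chained = chain-run k b₁ c (λ ()) refl start
    c′ = tickAll (chain k b₁ c) c
    open Final A-receives c′ (proj₂ chained) using (all-passed)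
    inv′ : Inv (suc j) (tickBlock (chain k b₁ c , edge (fromℕ (suc k))) c)
    inv′ = all-passed zero , all-passed b₁ , suc j , (λ y → all-passed (suc (suc y))) ,
           inj₁ (≤-refl , throughout-single A′)

  extend : ∀ j c → Inv j c → Extension Inv j c
  extend j c (c0 , c1 , L , rest , phase) with holder j ≟ᶠ zero | holder (suc j) ≟ᶠ zero | phase
  ... | yes A | yes A′ | inj₁ (L≤j , holds-A) =
        lockstep j c L c0 c1 rest
          (valid-edge-quiet c zero (subst (Quiet zero) (sym c0) (quiet-holding zero j A A′))
             (subst (Quiet b) (sym c1)
               (quiet-absent b j (λ eq → A≢B (trans (sym A) eq)) (λ eq → A≢B (trans (sym A′) eq)))))
          (inj₁ (m≤n⇒m≤1+n L≤j , throughout-extend holds-A A′))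
  ... | no ¬A | no ¬A′ | inj₂ (S , L≤S , S<j , holds-A , holds-B) =
        lockstep j c L c0 c1 rest
          (valid-edge-quiet c zero (subst (Quiet zero) (sym c0) (quiet-absent zero j ¬A ¬A′))
             (subst (Quiet b) (sym c1) (quiet-holding b j (not-A j ¬A) (not-A (suc j) ¬A′))))
          (inj₂ (S , L≤S , m≤n⇒m≤1+n S<j , holds-A , throughout-extend holds-B (not-A (suc j) ¬A′)))
  ... | yes A | no ¬A′ | inj₁ (L≤j , holds-A) =
        lockstep j c L c0 c1 rest
          (valid-edge-pass c zero (subst (Sends zero) (sym c0) (sends-on-loss zero j A ¬A′))
             (subst (Receives b) (sym c1)
               (receives-on-gain b j (λ eq → A≢B (trans (sym A) eq)) (not-A (suc j) ¬A′))))
          (inj₂ (j , L≤j , ≤-refl , holds-A , throughout-single (not-A (suc j) ¬A′)))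
  ... | no ¬A | yes A′ | inj₂ holds-B = B-sends j c L c0 c1 rest holds-B ¬A A′
  ... | yes A | _ | inj₂ (S , _ , S<j , _ , holds-B) = contradiction (trans (sym A) (holds-B j S<j ≤-refl)) A≢B
  ... | no ¬A | _ | inj₁ (L≤j , holds-A) = contradiction (holds-A j L≤j ≤-refl) ¬A

  inv-zero : Inv 0 (λ _ → 0)
  inv-zero = refl , refl , 0 , (λ _ → refl) , inj₁ (z≤n , throughout-single refl)

  open Construction Inv inv-zero extend public using (run; view)

sat-transfer : ∀ {S : Signature} {A B : Template S} {m m′ : ℕ}
                 (r′ : Ring.Run A B m′) (r : Ring.Run A B m) (p′ : Fin (suc m′)) (p : Fin (suc m)) →
               Stuttering (Ring.Run.movesOf r′ p′) (λ t a → Ring.Run.label r′ t (p′ , a))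
                          (Ring.Run.movesOf r p) (λ u a → Ring.Run.label r u (p , a)) →
               ∀ φ → ⟦ Ring.at A B m′ p′ φ ⟧ (Ring.Run.movesOf r′ p′) (Ring.Run.label r′) 0
                   ⇔ ⟦ Ring.at A B m p φ ⟧ (Ring.Run.movesOf r p) (Ring.Run.label r) 0
sat-transfer r′ r p′ p E φ =
  ⇔-trans (⟦⟧-mapLTL (p′ ,_) φ 0)
    (⇔-trans (subst (λ t → _ ⇔ ⟦ φ ⟧ (Ring.Run.movesOf r p) (λ u a → Ring.Run.label r u (p , a)) t)
                    (Stuttering.orig-zero E) (StutteringProperties.stuttering-invariant E φ 0))
             (⇔-sym (⟦⟧-mapLTL (p ,_) φ 0)))

mainTheorem19 : {S : Signature} (A B : Template S) →
    FairTemplate A → FairTemplate B →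
    (ψ : LTL (Signature.AP S)) (n : ℕ) → 1 ≤ n →
    (Ring.SatA A B 1 ψ ⇔ Ring.SatA A B n ψ) ×
    (Ring.SatB A B 1 ψ ⇔ Ring.SatB A B n ψ)
mainTheorem19 {S} A B _ _ ψ (suc k) _ = mk⇔ satA-merge satA-expand , mk⇔ satB-merge satB-expand
  where
  open Signature S
  -- SatA and SatB unfold to the semantics of at p ΦA and at p ΦB.
  ΦA ΦB : LTL AP
  ΦA = (Template.Aloc A ∧ₗ Gₗ (Fₗ (atom (inj₂ tok)))) ⇒ₗ ψ
  ΦB = (Template.Aloc B ∧ₗ Gₗ (Fₗ (atom (inj₂ tok)))) ⇒ₗ ψ

  satA-merge : Ring.SatA A B 1 ψ → Ring.SatA A B (suc k) ψ
  satA-merge sat r premise@(_ , recurs) =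
    to (sat-transfer M.run r zero zero (M.view zero (λ _ _ → proj₁)) ΦA) (sat M.run) premise
    where module M = MergeOntoA r (Token.holds-infinitely-often r zero recurs)

  satA-expand : Ring.SatA A B (suc k) ψ → Ring.SatA A B 1 ψ
  satA-expand sat r = to (sat-transfer E.run r zero zero (E.view zero (λ _ _ → proj₁)) ΦA) (sat E.run)
    where module E = Expand r k

  satB-merge : Ring.SatB A B 1 ψ → Ring.SatB A B (suc k) ψ
  satB-merge sat r i premise@(_ , recurs) =
    to (sat-transfer M.run r (suc zero) (suc i) (M.view (suc zero) (λ _ _ → proj₁)) ΦB) (sat M.run zero) premise
    where module M = MergeOntoB r i (Token.holds-infinitely-often r (suc i) recurs)

  satB-expand : Ring.SatB A B (suc k) ψ → Ring.SatB A B 1 ψ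
  satB-expand sat r zero =
    to (sat-transfer E.run r (suc zero) (suc zero) (E.view (suc zero) (λ _ _ → proj₁ ∘ proj₂)) ΦB)
       (sat E.run zero)
    where module E = Expand r k
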